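{- Let $\mathbb{V}=U\oplus W$ be a finite-dimensional vector space over a field $\mathcal{F}$, where $U$ and $W$ are nonzero subspaces and $\dim(\mathbb{V})>1$. Then the direct sum graph $\Gamma_{U\oplus W}(\mathbb{V})$ is complete if and only if $\dim(\mathbb{V})=2$.
   Context: Let $\mathbb{V}$ be a vector space over a field $\mathcal{F}$ with $\mathbb{V}=U\oplus W$, where $U,W$ are nonzero subspaces, $\dim U=r$, $\dim W=s$, $r+s=n=\dim\mathbb{V}$. Fix a basis $\{\alpha_1,\dots,\alpha_r\}$ of $U$ and a basis $\{\beta_1,\dots,\beta_s\}$ of $W$; every $x\in\mathbb{V}$ is written uniquely as $x=a_1\alpha_1+\dots+a_r\alpha_r+b_1\beta_1+\dots+b_s\beta_s$. The direct sum graph $\Gamma_{U\oplus W}(\mathbb{V})$ is the simple graph whose vertex set is $\{x=u+w: u\in U, w\in W, u\neq 0, w\neq 0\}$, in which two distinct vertices $x,y$ are adjacent iff there is an index $i$ such that the coefficient of $\alpha_i$ is nonzero in both $x$ and $y$, and there is an index $j$ such that the coefficient of $\beta_j$ is nonzero in both $x$ and $y$. -}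

module Defs where

open import Level using (Level; _⊔_) renaming (suc to lsuc)
open import Data.Nat using (ℕ)
open import Data.Fin using (Fin)
open import Data.Product using (Σ; ∃; _×_; _,_)
open import Relation.Nullary using (¬_)
open import Algebra.Bundles using (CommutativeRing)

record Field (c ℓ : Level) : Set (lsuc (c ⊔ ℓ)) where
  field
    commutativeRing : CommutativeRing c ℓ
  open CommutativeRing commutativeRing public
  field
    0≉1     : ¬ (0# ≈ 1#)
    inverse : ∀ x → ¬ (x ≈ 0#) → Σ Carrier (λ y → x * y ≈ 1#)

module DirectSumGraph {c ℓ : Level} (F : Field c ℓ) (r s : ℕ) where
  open Field F

  -- An element of V = U ⊕ W, written in the fixed basis
  -- α₁..αᵣ of U and β₁..βₛ of W: coordinates a (for U) and b (for W).
  record Vec : Set c where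
    constructor ⟨_,_⟩
    field
      a : Fin r → Carrier
      b : Fin s → Carrier
  open Vec public

  _≋_ : Vec → Vec → Set ℓ
  x ≋ y = (∀ i → a x i ≈ a y i) × (∀ j → b x j ≈ b y j)

  uNonzero : Vec → Set ℓ
  uNonzero x = ¬ (∀ i → a x i ≈ 0#)

  wNonzero : Vec → Set ℓ
  wNonzero x = ¬ (∀ j → b x j ≈ 0#)

  IsVertex : Vec → Set ℓ
  IsVertex x = uNonzero x × wNonzero x

  Adjacent : Vec → Vec → Set ℓ
  Adjacent x y =
    ∃ (λ (i : Fin r) → ¬ (a x i ≈ 0#) × ¬ (a y i ≈ 0#)) ×
    ∃ (λ (j : Fin s) → ¬ (b x j ≈ 0#) × ¬ (b y j ≈ 0#))

  IsComplete : Set (c ⊔ ℓ)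
  IsComplete = ∀ x y → IsVertex x → IsVertex y → ¬ (x ≋ y) → Adjacent x y

{-# OPTIONS --safe #-}
-- In dimension 1 + 1 every vertex has both of its coordinates nonzero, so any
-- two vertices are adjacent.  If instead dim U ≥ 2, the vertices α₁ + β₁ and
-- α₂ + β₁ are distinct but share no nonzero α-coordinate (symmetrically for W).
module Submission where

open import Defs
open import Level using (Level)
open import Data.Nat using (ℕ; _+_; _≤_; _<_; suc; s≤s; z≤n)
open import Data.Nat.Properties using (+-mono-≤; <-irrefl)
open import Data.Fin using (Fin; zero; suc; _≟_)
open import Data.Product using (_,_)
open import Data.Empty using (⊥-elim)
open import Function using (_∘_)
open import Relation.Nullary using (¬_; yes; no; contradiction)
open import Relation.Binary.PropositionalEquality using (_≡_; _≢_; refl; sym; trans; subst)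
open import Function.Bundles using (_⇔_; mk⇔)

module _ {c ℓ : Level} (F : Field c ℓ) where
  open Field F using (Carrier; _≈_; 0#; 1#; 0≉1) renaming (refl to ≈-refl; sym to ≈-sym; trans to ≈-trans)

  module _ {n : ℕ} where

    unit : Fin n → Fin n → Carrier
    unit i k with i ≟ k
    ... | yes _ = 1#
    ... | no  _ = 0#

    unit-self : ∀ i → unit i i ≈ 1#
    unit-self i with i ≟ i
    ... | yes _   = ≈-refl
    ... | no  i≢i = contradiction refl i≢i

    unit-off : ∀ {i k} → i ≢ k → unit i k ≈ 0#
    unit-off {i} {k} i≢k with i ≟ k
    ... | yes i≡k = contradiction i≡k i≢k
    ... | no  _   = ≈-refl

    unit-support : ∀ {i k} → ¬ (unit i k ≈ 0#) → i ≡ k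
    unit-support {i} {k} unit≉0 with i ≟ k
    ... | yes i≡k = i≡k
    ... | no  _   = contradiction ≈-refl unit≉0

    unit-nonzero : ∀ i → ¬ (∀ k → unit i k ≈ 0#)
    unit-nonzero i unit≈0 = 0≉1 (≈-trans (≈-sym (unit≈0 i)) (unit-self i))

  module _ {r s : ℕ} where
    open DirectSumGraph F r s

    unit-isVertex : ∀ i j → IsVertex ⟨ unit i , unit j ⟩
    unit-isVertex i j = unit-nonzero i , unit-nonzero j

    unit-distinctᵤ : ∀ {i i′} j j′ → i ≢ i′ → ¬ (⟨ unit i , unit j ⟩ ≋ ⟨ unit i′ , unit j′ ⟩)
    unit-distinctᵤ {i} _ _ i≢i′ (a≈ , _) =
      0≉1 (≈-trans (≈-sym (unit-off (i≢i′ ∘ sym))) (≈-trans (≈-sym (a≈ i)) (unit-self i)))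

    unit-distinctᵥ : ∀ i i′ {j j′} → j ≢ j′ → ¬ (⟨ unit i , unit j ⟩ ≋ ⟨ unit i′ , unit j′ ⟩)
    unit-distinctᵥ _ _ {j} j≢j′ (_ , b≈) =
      0≉1 (≈-trans (≈-sym (unit-off (j≢j′ ∘ sym))) (≈-trans (≈-sym (b≈ j)) (unit-self j)))

    unit-nonadjacentᵤ : ∀ {i i′} j j′ → i ≢ i′ → ¬ Adjacent ⟨ unit i , unit j ⟩ ⟨ unit i′ , unit j′ ⟩
    unit-nonadjacentᵤ _ _ i≢i′ ((_ , x≉0 , y≉0) , _) =
      i≢i′ (trans (unit-support x≉0) (sym (unit-support y≉0)))

    unit-nonadjacentᵥ : ∀ i i′ {j j′} → j ≢ j′ → ¬ Adjacent ⟨ unit i , unit j ⟩ ⟨ unit i′ , unit j′ ⟩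
    unit-nonadjacentᵥ _ _ j≢j′ (_ , (_ , x≉0 , y≉0)) =
      j≢j′ (trans (unit-support x≉0) (sym (unit-support y≉0)))

    ¬complete-of-distinctᵤ : ∀ {i i′} → i ≢ i′ → Fin s → ¬ IsComplete
    ¬complete-of-distinctᵤ {i} {i′} i≢i′ j complete =
      unit-nonadjacentᵤ j j i≢i′
        (complete _ _ (unit-isVertex i j) (unit-isVertex i′ j) (unit-distinctᵤ j j i≢i′))

    ¬complete-of-distinctᵥ : ∀ {j j′} → j ≢ j′ → Fin r → ¬ IsComplete
    ¬complete-of-distinctᵥ {j} {j′} j≢j′ i complete =
      unit-nonadjacentᵥ i i j≢j′
        (complete _ _ (unit-isVertex i j) (unit-isVertex i j′) (unit-distinctᵥ i i j≢j′))

  nonzero-coordinate : (f : Fin 1 → Carrier) → ¬ (∀ k → f k ≈ 0#) → ¬ (f zero ≈ 0#)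
  nonzero-coordinate f f≉0 f₀≈0 = f≉0 λ { zero → f₀≈0 }

  complete-1+1 : DirectSumGraph.IsComplete F 1 1
  complete-1+1 x y (ux , wx) (uy , wy) _ =
    (zero , nonzero-coordinate (a x) ux , nonzero-coordinate (a y) uy) ,
    (zero , nonzero-coordinate (b x) wx , nonzero-coordinate (b y) wy)
    where open DirectSumGraph F 1 1

2≤r⇒r+s≢2 : ∀ {r s} → 2 ≤ r → 1 ≤ s → r + s ≢ 2
2≤r⇒r+s≢2 2≤r 1≤s r+s≡2 = <-irrefl refl (subst (3 ≤_) r+s≡2 (+-mono-≤ 2≤r 1≤s))

theorem2p2 : ∀ {c ℓ : Level} (F : Field c ℓ) (r s : ℕ) →
    1 ≤ r → 1 ≤ s → 1 < r + s →
    (DirectSumGraph.IsComplete F r s ⇔ (r + s ≡ 2))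
theorem2p2 F 1 1 _ _ _ = mk⇔ (λ _ → refl) (λ _ → complete-1+1 F)
theorem2p2 F (suc (suc r)) (suc s) _ 1≤s _ =
  mk⇔ (⊥-elim ∘ ¬complete-of-distinctᵤ F {i = zero} {i′ = suc zero} (λ ()) zero)
      (⊥-elim ∘ 2≤r⇒r+s≢2 (s≤s (s≤s z≤n)) 1≤s)
theorem2p2 F 1 (suc (suc s)) _ _ _ =
  mk⇔ (⊥-elim ∘ ¬complete-of-distinctᵥ F {j = zero} {j′ = suc zero} (λ ()) zero)
      (λ ())
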